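{- Let $n\ge 2$ be an integer, $\log=\log_2$, and let $x_1(t),\dots,x_n(t)$ be the loads at time $t$ of the following process on the cycle with nodes $1,\dots,n$ (indices modulo $n$): at each step an edge $\{i,i+1\}$ is chosen uniformly at random, a weight $w(t)$ is drawn from a fixed distribution, and both endpoints are set to $(x_i(t)+x_{i+1}(t)+w(t))/2$. Define $\Delta_0=(n)$ and, for $1\le k\le\lfloor\log n\rfloor$, $\Delta_k=(\delta_k^1,\dots,\delta_k^{2^k})=(\alpha_k,\ \delta_{k-1}^1-\alpha_k,\ \alpha_k,\ \delta_{k-1}^2-\alpha_k,\dots,\alpha_k,\ \delta_{k-1}^{2^{k-1}}-\alpha_k)$, where $\alpha_k=\lfloor n/2^{k-1}\rfloor/2$ if $\lfloor n/2^{k-1}\rfloor$ is even and $\alpha_k=\lfloor\lceil n/2^{k-1}\rceil/2\rfloor$ otherwise. For $0\le k\le\lfloor\log n\rfloor$ and $1\le i\le n$ let \[A_k^i=\Big\{i,\ i+\delta_k^1,\ i+\delta_k^1+\delta_k^2,\ \dots,\ i+\textstyle\sum_{j=1}^{2^k-1}\delta_k^j\Big\}\pmod n\] (so $A_0^i=\{i\}$), and for a nonempty set $A$ of nodes let $Gap_A(t)=\max_{j\in A}x_j(t)-\min_{j\in A}x_j(t)$. Then for any $1\le i\le n$, any $0<k\le\lfloor\log n\rfloor$ and any time $t$, \[2\,Gap_{A_k^i}(t)\le 2\max_{j\in A_k^i}|x_j(t)-x_{j+\alpha_k}(t)|+Gap_{A_{k-1}^{i+\alpha_k}}(t)+Ga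p_{A_{k-1}^i}(t).\]
   Context: Node indices are taken modulo $n$, i.e. $x_{j+n}(t)=x_j(t)$.
   Formalization: The loads $x_j(t)$ are rational rather than real. -}

module Defs where

open import Data.Nat as ℕ using (ℕ; zero; suc; NonZero; _≡ᵇ_; _^_; _∸_)
open import Data.Nat.Properties using (m^n≢0)
open import Data.Integer as ℤ using (ℤ; +_; _%ℕ_)
open import Data.Integer.DivMod using (n%ℕd<d)
open import Data.Rational as ℚ using (ℚ; _⊔_; _⊓_; _-_; ∣_∣)
open import Data.Fin using (Fin; fromℕ<)
open import Data.List using (List; []; _∷_; map; concatMap)
open import Data.Bool using (if_then_else_)

-- α_k for k ≥ 1, written as α (suc j) with k-1 = j:
--   m = ⌊n / 2^(k-1)⌋ ; α_k = m/2 if m even, else ⌊⌈n/2^(k-1)⌉/2⌋.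
αₖ : ℕ → ℕ → ℕ
αₖ n zero = 0   -- unused (α_0 is not defined in the paper)
αₖ n (suc j) =
  let instance _ = m^n≢0 2 j
      m = n ℕ./ (2 ^ j)
      c = (n ℕ.+ (2 ^ j ∸ 1)) ℕ./ (2 ^ j)
  in if (m ℕ.% 2 ≡ᵇ 0) then m ℕ./ 2 else c ℕ./ 2

Δ : ℕ → ℕ → List ℤ
Δ n zero = (+ n) ∷ []
Δ n (suc k) = concatMap (λ d → (+ αₖ n (suc k)) ∷ (d ℤ.- (+ αₖ n (suc k))) ∷ []) (Δ n k)

offsets : List ℤ → List ℤ
offsets [] = []
offsets (d ∷ ds) = (+ 0) ∷ map (λ e → d ℤ.+ e) (offsets ds)

node : (n : ℕ) .{{_ : NonZero n}} → ℤ → Fin n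
node n z = fromℕ< (n%ℕd<d z n)

shift : (n : ℕ) .{{_ : NonZero n}} → Fin n → ℕ → Fin n
shift n j a = node n (+ Data.Fin.toℕ j ℤ.+ + a)

-- A_k^i as a list of nodes (0-based node labels 0,…,n-1)
A : (n : ℕ) .{{_ : NonZero n}} → ℕ → Fin n → List (Fin n)
A n k i = map (λ o → node n (+ Data.Fin.toℕ i ℤ.+ o)) (offsets (Δ n k))

maxL : ℚ → List ℚ → ℚ
maxL a [] = a
maxL a (b ∷ bs) = a ⊔ maxL b bs

minL : ℚ → List ℚ → ℚ
minL a [] = a
minL a (b ∷ bs) = a ⊓ minL b bs

-- max over a list of nodes of f (value 0 for the empty list; only used on nonempty A)
maxOver : ∀ {n} → (Fin n → ℚ) → List (Fin n) → ℚ
maxOver f [] = ℚ.0ℚ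
maxOver f (j ∷ js) = maxL (f j) (map f js)

minOver : ∀ {n} → (Fin n → ℚ) → List (Fin n) → ℚ
minOver f [] = ℚ.0ℚ
minOver f (j ∷ js) = minL (f j) (map f js)

Gap : ∀ {n} → (Fin n → ℚ) → List (Fin n) → ℚ
Gap x As = maxOver x As - minOver x As

twoℚ : ℚ
twoℚ = ℚ.1ℚ ℚ.+ ℚ.1ℚ

-- The offset list of Δ_k is that of Δ_{k-1} with every offset o followed by o + α_k, so A_k^i
-- is B = A_{k-1}^i interleaved with its translate C = A_{k-1}^{i+α_k}, and every node of C is
-- j + α_k for a node j of B.  If M bounds |x_j - x_{j+α_k}| on B, the maxima of x over B and C
-- differ by at most M, and so do the minima.  Since 2 max(u, u') ≤ u + u' + |u - u'| and
-- 2 min(l, l') ≥ l + l' - |l - l'|, twice the gap of B ∪ C is at most 2M + Gap_C + Gap_B.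
module Submission where

open import Defs
open import Data.Nat using (ℕ; NonZero; _≤_; _<_)
open import Data.Nat.Logarithm using (⌊log₂_⌋)
open import Data.Fin using (Fin)
open import Data.Rational using (ℚ; _-_; ∣_∣; _*_) renaming (_+_ to _+ℚ_; _≤_ to _≤ℚ_)
open import Data.Rational using (mkℚ; *≤*; _⊔_; _⊓_; -_; 1ℚ)

import Data.Nat as ℕ
open import Data.Integer as ℤ using (+_; -[1+_]; +[1+_]; _%ℕ_; _/ℕ_)
import Data.Integer.Properties as ℤ
open import Data.Integer.DivMod using (a≡a%ℕn+[a/ℕn]*n; n%ℕd<d)
open import Algebra.Properties.AbelianGroup ℤ.+-0-abelianGroup using () renaming (∙-cancelʳ to +-cancelʳ)
import Data.Integer.Solver as ℤ-Solver
import Data.Rational.Properties as ℚ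
import Data.Rational.Solver as ℚ-Solver
import Data.Fin as Fin
import Data.Fin.Properties as Fin
open import Data.List using (List; []; _∷_; map; concatMap)
open import Data.List.Properties using (map-∘; map-cong)
open import Data.List.Relation.Unary.All as All using (All; []; _∷_)
open import Data.Product using (∃₂; _×_; _,_; proj₁)
open import Data.Sum using (inj₁; inj₂)
open import Function using (_∘_)
open import Relation.Binary.Definitions using (tri<; tri≈; tri>)
open import Relation.Binary.PropositionalEquality
open import Relation.Nullary using (contradiction)

module _ where
  open ℚ-Solver.+-*-Solver

  p≤∣p∣ : ∀ p → p ≤ℚ ∣ p ∣
  p≤∣p∣ (mkℚ +[1+ _ ] _ _) = ℚ.≤-refl
  p≤∣p∣ (mkℚ (+ 0) _ _) = ℚ.≤-refl
  p≤∣p∣ (mkℚ -[1+ _ ] _ _) = *≤* ℤ.-≤+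

  ∣p-q∣≤r⇒p≤q+r : ∀ {p q r} → ∣ p - q ∣ ≤ℚ r → p ≤ℚ q +ℚ r
  ∣p-q∣≤r⇒p≤q+r {p} {q} {r} h = begin
    p             ≡⟨ solve 2 (λ p q → p := q :+ (p :- q)) refl p q ⟩
    q +ℚ (p - q)  ≤⟨ ℚ.+-monoʳ-≤ q (ℚ.≤-trans (p≤∣p∣ (p - q)) h) ⟩
    q +ℚ r        ∎
    where open ℚ.≤-Reasoning

  ∣p-q∣≤r⇒q≤p+r : ∀ {p q r} → ∣ p - q ∣ ≤ℚ r → q ≤ℚ p +ℚ r
  ∣p-q∣≤r⇒q≤p+r {p} {q} h = ∣p-q∣≤r⇒p≤q+r (subst (_≤ℚ _) ∣p-q∣≡∣q-p∣ h)
    where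
    ∣p-q∣≡∣q-p∣ : ∣ p - q ∣ ≡ ∣ q - p ∣
    ∣p-q∣≡∣q-p∣ = trans (sym (ℚ.∣-p∣≡∣p∣ (p - q)))
                       (cong ∣_∣ (solve 2 (λ p q → :- (p :- q) := q :- p) refl p q))

  ⊔-≤-+ : ∀ {p q} p′ q′ r → p ≤ℚ p′ +ℚ r → q ≤ℚ q′ +ℚ r → p ⊔ q ≤ℚ (p′ ⊔ q′) +ℚ r
  ⊔-≤-+ {p} {q} p′ q′ r hp hq with ℚ.⊔-sel p q
  ... | inj₁ p⊔q≡p rewrite p⊔q≡p = ℚ.≤-trans hp (ℚ.+-monoˡ-≤ r (ℚ.p≤p⊔q p′ q′))
  ... | inj₂ p⊔q≡q rewrite p⊔q≡q = ℚ.≤-trans hq (ℚ.+-monoˡ-≤ r (ℚ.p≤q⊔p p′ q′))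

  ⊓-≤-+ : ∀ {p q} p′ q′ r → p ≤ℚ p′ +ℚ r → q ≤ℚ q′ +ℚ r → p ⊓ q ≤ℚ (p′ ⊓ q′) +ℚ r
  ⊓-≤-+ {p} {q} p′ q′ r hp hq with ℚ.⊓-sel p′ q′
  ... | inj₁ p′⊓q′≡p′ rewrite p′⊓q′≡p′ = ℚ.≤-trans (ℚ.p⊓q≤p p q) hp
  ... | inj₂ p′⊓q′≡q′ rewrite p′⊓q′≡q′ = ℚ.≤-trans (ℚ.p⊓q≤q p q) hq

  ⊔-double-≤ : ∀ {p q r} → p ≤ℚ q +ℚ r → q ≤ℚ p +ℚ r → (p ⊔ q) +ℚ (p ⊔ q) ≤ℚ (p +ℚ q) +ℚ r
  ⊔-double-≤ {p} {q} {r} hp hq with ℚ.⊔-sel p q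
  ... | inj₁ p⊔q≡p rewrite p⊔q≡p =
    subst (p +ℚ p ≤ℚ_) (solve 3 (λ p q r → p :+ (q :+ r) := (p :+ q) :+ r) refl p q r) (ℚ.+-monoʳ-≤ p hp)
  ... | inj₂ p⊔q≡q rewrite p⊔q≡q =
    subst (q +ℚ q ≤ℚ_) (solve 3 (λ p q r → (p :+ r) :+ q := (p :+ q) :+ r) refl p q r) (ℚ.+-monoˡ-≤ q hq)

  ⊓-double-≥ : ∀ {p q r} → p ≤ℚ q +ℚ r → q ≤ℚ p +ℚ r → p +ℚ q ≤ℚ ((p ⊓ q) +ℚ (p ⊓ q)) +ℚ r
  ⊓-double-≥ {p} {q} {r} hp hq with ℚ.⊓-sel p q
  ... | inj₁ p⊓q≡p rewrite p⊓q≡p =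
    subst (p +ℚ q ≤ℚ_) (solve 3 (λ p q r → p :+ (p :+ r) := (p :+ p) :+ r) refl p q r) (ℚ.+-monoʳ-≤ p hq)
  ... | inj₂ p⊓q≡q rewrite p⊓q≡q =
    subst (p +ℚ q ≤ℚ_) (solve 3 (λ p q r → (q :+ r) :+ q := (q :+ q) :+ r) refl p q r) (ℚ.+-monoˡ-≤ q hp)

  gap-of-union : ∀ {U L u u′ l l′ r} → U ≤ℚ u ⊔ u′ → l ⊓ l′ ≤ℚ L →
                 u ≤ℚ u′ +ℚ r → u′ ≤ℚ u +ℚ r → l ≤ℚ l′ +ℚ r → l′ ≤ℚ l +ℚ r →
                 twoℚ * (U - L) ≤ℚ twoℚ * r +ℚ (u′ - l′) +ℚ (u - l)
  gap-of-union {U} {L} {u} {u′} {l} {l′} {r} U≤ ≤L hu hu′ hl hl′ = begin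
    twoℚ * (U - L)
      ≡⟨ solve 2 (λ U L → (con 1ℚ :+ con 1ℚ) :* (U :- L) := (U :+ U) :- (L :+ L)) refl U L ⟩
    (U +ℚ U) - (L +ℚ L)
      ≤⟨ ℚ.+-mono-≤ (ℚ.+-mono-≤ U≤ U≤) (ℚ.neg-antimono-≤ (ℚ.+-mono-≤ ≤L ≤L)) ⟩
    ((u ⊔ u′) +ℚ (u ⊔ u′)) - ((l ⊓ l′) +ℚ (l ⊓ l′))
      ≤⟨ ℚ.+-mono-≤ (⊔-double-≤ hu hu′) (ℚ.neg-antimono-≤ (sub (⊓-double-≥ hl hl′))) ⟩
    ((u +ℚ u′) +ℚ r) - ((l +ℚ l′) - r)
      ≡⟨ solve 5 (λ u u′ l l′ r → ((u :+ u′) :+ r) :- ((l :+ l′) :- r)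
                                  := (con 1ℚ :+ con 1ℚ) :* r :+ (u′ :- l′) :+ (u :- l)) refl u u′ l l′ r ⟩
    twoℚ * r +ℚ (u′ - l′) +ℚ (u - l)
      ∎
    where
    open ℚ.≤-Reasoning
    sub : ∀ {p q} → p ≤ℚ q +ℚ r → p - r ≤ℚ q
    sub {p} {q} h = subst (p - r ≤ℚ_) (solve 2 (λ q r → (q :+ r) :- r := q) refl q r) (ℚ.+-monoˡ-≤ (- r) h)

module _ {n : ℕ} where

  maxOver-ub : ∀ (f : Fin n → ℚ) vs → All (λ v → f v ≤ℚ maxOver f vs) vs
  maxOver-ub f [] = []
  maxOver-ub f (v ∷ []) = ℚ.≤-refl ∷ []
  maxOver-ub f (v ∷ w ∷ ws) =
    ℚ.p≤p⊔q (f v) m ∷ All.map (λ h → ℚ.≤-trans h (ℚ.p≤q⊔p (f v) m)) (maxOver-ub f (w ∷ ws))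
    where m = maxOver f (w ∷ ws)

  maxOver-lub : ∀ (f : Fin n → ℚ) {b} v vs → All (λ w → f w ≤ℚ b) (v ∷ vs) → maxOver f (v ∷ vs) ≤ℚ b
  maxOver-lub f v [] (h ∷ []) = h
  maxOver-lub f v (w ∷ ws) (h ∷ hs) = ℚ.⊔-lub h (maxOver-lub f w ws hs)

  minOver-lb : ∀ (f : Fin n → ℚ) vs → All (λ v → minOver f vs ≤ℚ f v) vs
  minOver-lb f [] = []
  minOver-lb f (v ∷ []) = ℚ.≤-refl ∷ []
  minOver-lb f (v ∷ w ∷ ws) =
    ℚ.p⊓q≤p (f v) m ∷ All.map (ℚ.≤-trans (ℚ.p⊓q≤q (f v) m)) (minOver-lb f (w ∷ ws))
    where m = minOver f (w ∷ ws)

  minOver-glb : ∀ (f : Fin n → ℚ) {b} v vs → All (λ w → b ≤ℚ f w) (v ∷ vs) → b ≤ℚ minOver f (v ∷ vs)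
  minOver-glb f v [] (h ∷ []) = h
  minOver-glb f v (w ∷ ws) (h ∷ hs) = ℚ.⊓-glb h (minOver-glb f w ws hs)

  maxOver-≤-+ : ∀ {f g : Fin n → ℚ} {r} v vs → All (λ w → f w ≤ℚ g w +ℚ r) (v ∷ vs) →
                maxOver f (v ∷ vs) ≤ℚ maxOver g (v ∷ vs) +ℚ r
  maxOver-≤-+ v [] (h ∷ []) = h
  maxOver-≤-+ {f} {g} {r} v (w ∷ ws) (h ∷ hs) = ⊔-≤-+ (g v) (maxOver g (w ∷ ws)) r h (maxOver-≤-+ {f} {g} w ws hs)

  minOver-≤-+ : ∀ {f g : Fin n → ℚ} {r} v vs → All (λ w → f w ≤ℚ g w +ℚ r) (v ∷ vs) →
                minOver f (v ∷ vs) ≤ℚ minOver g (v ∷ vs) +ℚ r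
  minOver-≤-+ v [] (h ∷ []) = h
  minOver-≤-+ {f} {g} {r} v (w ∷ ws) (h ∷ hs) = ⊓-≤-+ (g v) (minOver g (w ∷ ws)) r h (minOver-≤-+ {f} {g} w ws hs)

  maxOver-map : ∀ (f : Fin n → ℚ) (σ : Fin n → Fin n) vs → maxOver f (map σ vs) ≡ maxOver (f ∘ σ) vs
  maxOver-map f σ [] = refl
  maxOver-map f σ (v ∷ vs) = cong (maxL (f (σ v))) (sym (map-∘ vs))

  minOver-map : ∀ (f : Fin n → ℚ) (σ : Fin n → Fin n) vs → minOver f (map σ vs) ≡ minOver (f ∘ σ) vs
  minOver-map f σ [] = refl
  minOver-map f σ (v ∷ vs) = cong (minL (f (σ v))) (sym (map-∘ vs))

withImages : {A : Set} → (A → A) → List A → List A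
withImages σ = concatMap (λ v → v ∷ σ v ∷ [])

module _ {A : Set} {P : A → Set} (σ : A → A) where

  All-withImages⁺ : ∀ {vs} → All (λ v → P v × P (σ v)) vs → All P (withImages σ vs)
  All-withImages⁺ [] = []
  All-withImages⁺ ((p , q) ∷ pqs) = p ∷ q ∷ All-withImages⁺ pqs

  All-withImages⁻ : ∀ vs → All P (withImages σ vs) → All (λ v → P v × P (σ v)) vs
  All-withImages⁻ [] [] = []
  All-withImages⁻ (v ∷ vs) (p ∷ q ∷ pqs) = (p , q) ∷ All-withImages⁻ vs pqs

map-withImages : ∀ {A B : Set} {f : A → B} {τ : A → A} {σ : B → B} →
                 (∀ a → f (τ a) ≡ σ (f a)) → ∀ as → map f (withImages τ as) ≡ withImages σ (map f as)
map-withImages comm [] = refl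
map-withImages {f = f} comm (a ∷ as) = cong (f a ∷_) (cong₂ _∷_ (comm a) (map-withImages comm as))

gap-withImages : ∀ {n} (x : Fin n → ℚ) (σ : Fin n → Fin n) {r} v vs →
                 All (λ w → ∣ x w - x (σ w) ∣ ≤ℚ r) (v ∷ vs) →
                 twoℚ * Gap x (withImages σ (v ∷ vs)) ≤ℚ twoℚ * r +ℚ Gap x (map σ (v ∷ vs)) +ℚ Gap x (v ∷ vs)
gap-withImages x σ {r} v vs close =
  subst₂ (λ u′ l′ → twoℚ * Gap x B∪C ≤ℚ twoℚ * r +ℚ (u′ - l′) +ℚ Gap x B)
    (sym (maxOver-map x σ B)) (sym (minOver-map x σ B))
    (gap-of-union {r = r} max≤ ≤min
      (maxOver-≤-+ v vs below) (maxOver-≤-+ v vs above)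
      (minOver-≤-+ v vs below) (minOver-≤-+ v vs above))
  where
  B = v ∷ vs
  B∪C = withImages σ B
  u = maxOver x B
  u′ = maxOver (x ∘ σ) B
  l = minOver x B
  l′ = minOver (x ∘ σ) B
  below : All (λ w → x w ≤ℚ x (σ w) +ℚ r) B
  below = All.map (λ {w} → ∣p-q∣≤r⇒p≤q+r {x w}) close
  above : All (λ w → x (σ w) ≤ℚ x w +ℚ r) B
  above = All.map (λ {w} → ∣p-q∣≤r⇒q≤p+r {x w}) close
  max≤ : maxOver x B∪C ≤ℚ u ⊔ u′
  max≤ = maxOver-lub x v (σ v ∷ withImages σ vs) (All-withImages⁺ σ
           (All.zipWith (λ (hu , hu′) → ℚ.≤-trans hu (ℚ.p≤p⊔q u u′) , ℚ.≤-trans hu′ (ℚ.p≤q⊔p u u′))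
                        (maxOver-ub x B , maxOver-ub (x ∘ σ) B)))
  ≤min : l ⊓ l′ ≤ℚ minOver x B∪C
  ≤min = minOver-glb x v (σ v ∷ withImages σ vs) (All-withImages⁺ σ
           (All.zipWith (λ (hl , hl′) → ℚ.≤-trans (ℚ.p⊓q≤p l l′) hl , ℚ.≤-trans (ℚ.p⊓q≤q l l′) hl′)
                        (minOver-lb x B , minOver-lb (x ∘ σ) B)))

next-multiple-≤ : ∀ {n r₁ r₂} q₁ q₂ → q₁ ℤ.< q₂ → + r₁ ℤ.+ q₁ ℤ.* + n ≡ + r₂ ℤ.+ q₂ ℤ.* + n →
                  + n ℤ.+ q₁ ℤ.* + n ℤ.≤ + r₁ ℤ.+ q₁ ℤ.* + n
next-multiple-≤ {n} {r₁} {r₂} q₁ q₂ q₁<q₂ eq = begin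
  + n ℤ.+ q₁ ℤ.* + n     ≡⟨ ℤ.suc-* q₁ (+ n) ⟨
  ℤ.suc q₁ ℤ.* + n       ≤⟨ ℤ.*-monoʳ-≤-nonNeg (+ n) (ℤ.i<j⇒suc[i]≤j q₁<q₂) ⟩
  q₂ ℤ.* + n             ≤⟨ ℤ.i≤j+i (q₂ ℤ.* + n) (+ r₂) ⟩
  + r₂ ℤ.+ q₂ ℤ.* + n    ≡⟨ eq ⟨
  + r₁ ℤ.+ q₁ ℤ.* + n    ∎
  where open ℤ.≤-Reasoning

remainder-unique : ∀ {n r₁ r₂} q₁ q₂ → r₁ ℕ.< n → r₂ ℕ.< n →
                   + r₁ ℤ.+ q₁ ℤ.* + n ≡ + r₂ ℤ.+ q₂ ℤ.* + n → r₁ ≡ r₂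
remainder-unique {n} q₁ q₂ r₁<n r₂<n eq with ℤ.<-cmp q₁ q₂
... | tri< q₁<q₂ _ _ = contradiction (next-multiple-≤ q₁ q₂ q₁<q₂ eq) (ℤ.<⇒≱ (ℤ.+-monoˡ-< (q₁ ℤ.* + n) (ℤ.+<+ r₁<n)))
... | tri≈ _ refl _ = ℤ.+-injective (+-cancelʳ (q₁ ℤ.* + n) _ _ eq)
... | tri> _ _ q₂<q₁ = sym (contradiction (next-multiple-≤ q₂ q₁ q₂<q₁ (sym eq)) (ℤ.<⇒≱ (ℤ.+-monoˡ-< (q₂ ℤ.* + n) (ℤ.+<+ r₂<n))))

%ℕ-+-multiple : ∀ z q n .{{_ : NonZero n}} → (z ℤ.+ q ℤ.* + n) %ℕ n ≡ z %ℕ n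
%ℕ-+-multiple z q n = remainder-unique (w /ℕ n) (z /ℕ n ℤ.+ q) (n%ℕd<d w n) (n%ℕd<d z n) (begin
  + (w %ℕ n) ℤ.+ (w /ℕ n) ℤ.* + n                  ≡⟨ a≡a%ℕn+[a/ℕn]*n w n ⟨
  z ℤ.+ q ℤ.* + n                                  ≡⟨ cong (ℤ._+ q ℤ.* + n) (a≡a%ℕn+[a/ℕn]*n z n) ⟩
  (+ (z %ℕ n) ℤ.+ (z /ℕ n) ℤ.* + n) ℤ.+ q ℤ.* + n  ≡⟨ solve 4 (λ r d q n → (r :+ d :* n) :+ q :* n := r :+ (d :+ q) :* n)
                                                            refl (+ (z %ℕ n)) (z /ℕ n) q (+ n) ⟩
  + (z %ℕ n) ℤ.+ (z /ℕ n ℤ.+ q) ℤ.* + n            ∎)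
  where
  w = z ℤ.+ q ℤ.* + n
  open ≡-Reasoning
  open ℤ-Solver.+-*-Solver

node-+ : ∀ n .{{_ : NonZero n}} z w → node n (+ Fin.toℕ (node n z) ℤ.+ w) ≡ node n (z ℤ.+ w)
node-+ n z w = Fin.fromℕ<-cong _ _ same-remainder _ _
  where
  open ℤ-Solver.+-*-Solver
  same-remainder : (+ Fin.toℕ (node n z) ℤ.+ w) %ℕ n ≡ (z ℤ.+ w) %ℕ n
  same-remainder rewrite Fin.toℕ-fromℕ< (n%ℕd<d z n) = sym (begin
    (z ℤ.+ w) %ℕ n
      ≡⟨ cong (λ z → (z ℤ.+ w) %ℕ n) (a≡a%ℕn+[a/ℕn]*n z n) ⟩
    ((+ (z %ℕ n) ℤ.+ (z /ℕ n) ℤ.* + n) ℤ.+ w) %ℕ n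
      ≡⟨ cong (_%ℕ n) (solve 4 (λ r d w n → (r :+ d :* n) :+ w := (r :+ w) :+ d :* n) refl (+ (z %ℕ n)) (z /ℕ n) w (+ n)) ⟩
    ((+ (z %ℕ n) ℤ.+ w) ℤ.+ (z /ℕ n) ℤ.* + n) %ℕ n
      ≡⟨ %ℕ-+-multiple (+ (z %ℕ n) ℤ.+ w) (z /ℕ n) n ⟩
    (+ (z %ℕ n) ℤ.+ w) %ℕ n
      ∎)
    where open ≡-Reasoning

offsets-split : ∀ a ds → offsets (concatMap (λ d → a ∷ (d ℤ.- a) ∷ []) ds) ≡ withImages (ℤ._+ a) (offsets ds)
offsets-split a [] = refl
offsets-split a (d ∷ ds) = cong (+ 0 ∷_) (cong₂ _∷_ (ℤ.+-comm a (+ 0)) (begin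
  map (λ e → a ℤ.+ e) (map (λ e → (d ℤ.- a) ℤ.+ e) (offsets rest))
    ≡⟨ map-∘ (offsets rest) ⟨
  map (λ e → a ℤ.+ ((d ℤ.- a) ℤ.+ e)) (offsets rest)
    ≡⟨ map-cong (solve 3 (λ a d e → a :+ ((d :- a) :+ e) := d :+ e) refl a d) (offsets rest) ⟩
  map (λ e → d ℤ.+ e) (offsets rest)
    ≡⟨ cong (map (λ e → d ℤ.+ e)) (offsets-split a ds) ⟩
  map (λ e → d ℤ.+ e) (withImages (ℤ._+ a) (offsets ds))
    ≡⟨ map-withImages (λ e → sym (ℤ.+-assoc d e a)) (offsets ds) ⟩
  withImages (ℤ._+ a) (map (λ e → d ℤ.+ e) (offsets ds))
    ∎))
  where
  rest = concatMap (λ d → a ∷ (d ℤ.- a) ∷ []) ds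
  open ≡-Reasoning
  open ℤ-Solver.+-*-Solver

Δ-nonEmpty : ∀ n k → ∃₂ λ d ds → Δ n k ≡ d ∷ ds
Δ-nonEmpty n ℕ.zero = _ , _ , refl
Δ-nonEmpty n (ℕ.suc k) with Δ-nonEmpty n k
... | _ , _ , Δ≡d∷ds rewrite Δ≡d∷ds = _ , _ , refl

module _ (n : ℕ) .{{_ : NonZero n}} where

  A-nonEmpty : ∀ k i → ∃₂ λ v vs → A n k i ≡ v ∷ vs
  A-nonEmpty k i with Δ-nonEmpty n k
  ... | _ , _ , Δ≡d∷ds rewrite Δ≡d∷ds = _ , _ , refl

  A-suc : ∀ k i → A n (ℕ.suc k) i ≡ withImages (λ v → shift n v (αₖ n (ℕ.suc k))) (A n k i)
  A-suc k i = trans (cong (map (λ o → node n (+ Fin.toℕ i ℤ.+ o))) (offsets-split (+ α) (Δ n k)))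
                    (map-withImages translate (offsets (Δ n k)))
    where
    α = αₖ n (ℕ.suc k)
    translate : ∀ o → node n (+ Fin.toℕ i ℤ.+ (o ℤ.+ + α)) ≡ shift n (node n (+ Fin.toℕ i ℤ.+ o)) α
    translate o = trans (cong (node n) (sym (ℤ.+-assoc (+ Fin.toℕ i) o (+ α)))) (sym (node-+ n (+ Fin.toℕ i ℤ.+ o) (+ α)))

  A-shift : ∀ k i a → A n k (shift n i a) ≡ map (λ v → shift n v a) (A n k i)
  A-shift k i a = trans (map-cong translate (offsets (Δ n k))) (map-∘ (offsets (Δ n k)))
    where
    open ℤ-Solver.+-*-Solver
    ti = + Fin.toℕ i
    translate : ∀ o → node n (+ Fin.toℕ (shift n i a) ℤ.+ o) ≡ shift n (node n (ti ℤ.+ o)) a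
    translate o = begin
      node n (+ Fin.toℕ (shift n i a) ℤ.+ o)  ≡⟨ node-+ n (ti ℤ.+ + a) o ⟩
      node n ((ti ℤ.+ + a) ℤ.+ o)             ≡⟨ cong (node n) (solve 3 (λ t a o → (t :+ a) :+ o := (t :+ o) :+ a) refl ti (+ a) o) ⟩
      node n ((ti ℤ.+ o) ℤ.+ + a)             ≡⟨ node-+ n (ti ℤ.+ o) (+ a) ⟨
      shift n (node n (ti ℤ.+ o)) a           ∎
      where open ≡-Reasoning

lemma5 : (n : ℕ) .{{_ : NonZero n}} → 2 ≤ n → (x : Fin n → ℚ) → (i : Fin n) → (k : ℕ) → 0 < k → k ≤ ⌊log₂ n ⌋ →
    twoℚ * Gap x (A n k i)
      ≤ℚ twoℚ * maxOver (λ j → ∣ x j - x (shift n j (αₖ n k)) ∣) (A n k i)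
        +ℚ Gap x (A n (k Data.Nat.∸ 1) (shift n i (αₖ n k)))
        +ℚ Gap x (A n (k Data.Nat.∸ 1) i)
lemma5 n _ x i (ℕ.suc k) _ _ with A-nonEmpty n k i
... | v , vs , A≡v∷vs rewrite A-suc n k i | A-shift n k i (αₖ n (ℕ.suc k)) | A≡v∷vs =
  gap-withImages x σ v vs (All.map proj₁ (All-withImages⁻ σ (v ∷ vs) (maxOver-ub _ (withImages σ (v ∷ vs)))))
  where
  σ : Fin n → Fin n
  σ j = shift n j (αₖ n (ℕ.suc k))
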